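{- Let $\mathbb{F}=(\mathbb{P},R_\Box,R_\Diamond)$ be an enriched formal context with $\mathbb{P}=(G,M,I)$, and let $V:\mathrm{P}\to\mathbb{P}^+$ be a valuation. Then for every formula $\varphi\in\mathcal{L}$ and every $g\in G$ (resp. $m\in M$): $V,g\Vdash\varphi$ (resp. $V,m\not\succ\varphi$) if and only if $\exists$ has a winning strategy in the evaluation game on $\mathbb{F}$ (with valuation $V$) starting from position $(g,\varphi)$ (resp. $(m,\varphi)$).
   Context: Language: $\mathcal{L}$ is given by $\varphi::=\bot\mid\top\mid p\mid\varphi\wedge\varphi\mid\varphi\vee\varphi\mid\Box\varphi\mid\Diamond\varphi$ with $p$ ranging over a countable set $\mathrm{P}$ of atoms. Polarities: a polarity is $\mathbb{P}=(G,M,I)$ with $I\subseteq G\times M$. For a relation $T\subseteq U\times W$, $U'\subseteq U$, $W'\subseteq W$, put $T^{(1)}[U']=\{w\mid \forall u\in U'\ uTw\}$ and $T^{(0)}[W']=\{u\mid\forall w\in W'\ uTw\}$ (singletons written without braces). Let $B^\uparrow=I^{(1)}[B]$ for $B\subseteq G$ and $Y^\downarrow=I^{(0)}[Y]$ for $Y\subseteq M$; a set is Galois-stable if it is a fixed point of $(\cdot)^{\uparrow\downarrow}$ resp. $(\cdot)^{\downarrow\uparrow}$. A formal concept is a pair $c=(B,Y)$ with $B=Y^\downarrow$, $Y=B^\uparrow$; write $[\![c]\!]=B$ (extension) and $(\![c]\!)=Y$ (intension). Concepts ordered by $c_1\le c_2$ iff $[\![c_1]\!]\subseteq[\![c_2]\!]$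 form a complete lattice $\mathbb{P}^+$. An enriched formal context is $\mathbb{F}=(\mathbb{P},R_\Box,R_\Diamond)$ with $R_\Box\subseteq G\times M$, $R_\Diamond\subseteq M\times G$ $I$-compatible, i.e. $R_\Box^{(0)}[m]$, $R_\Box^{(1)}[g]$, $R_\Diamond^{(0)}[g]$, $R_\Diamond^{(1)}[m]$ are Galois-stable for all $g\in G,m\in M$. On $\mathbb{P}^+$ define $[R_\Box]c=(R_\Box^{(0)}[(\![c]\!)],I^{(1)}[R_\Box^{(0)}[(\![c]\!)]])$ and $\langle R_\Diamond\rangle c=(I^{(0)}[R_\Diamond^{(0)}[[\![c]\!]]],R_\Diamond^{(0)}[[\![c]\!]])$. Semantics: a valuation $V:\mathrm{P}\to\mathbb{P}^+$ is extended to all formulas by interpreting $\top,\bot,\wedge,\vee$ as top, bottom, meet, join of $\mathbb{P}^+$, $\Box$ as $[R_\Box]$ and $\Diamond$ as $\langle R_\Diamond\rangle$. Then $V,g\Vdash\varphi$ iff $g\in[\![V(\varphi)]\!]$ and $V,m\succ\varphi$ iff $m\in(\![V(\varphi)]\!)$. Game: two players $\exists$ and $\forall$. A play is a sequence of positions where each next position is an admissible move chosen by the player owning the current position; a player who must move but has no admissible move loses; infinite plays are won by $\forall$. A strategy for a player assigns to each partial play ending in a position of that player an admissible move; it is winning from a position if every play from that position following it is won by that player. Writing $I^c=(G\times M)\setminus I$, $R_\Box^c=(G\times M)\setminus R_\Box$, $R_\Diamond^c=(M\times G)\setminus R_\Diamond$, positions are pairs $(g,\varphi)$, $(m,\varphi)$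 with the following owners and admissible moves: $(g,p)$ with $V,g\Vdash p$: $\forall$, no moves; $(g,p)$ with $V,g\not\Vdash p$: $\forall$, $\{(m,p)\mid gI^cm\}$; $(m,p)$ with $V,m\succ p$: $\exists$, no moves; $(m,p)$ with $V,m\not\succ p$: $\exists$, $\{(g,p)\mid gI^cm\}$; $(g,\top)$: $\forall$, no moves; $(m,\bot)$: $\exists$, no moves; $(g,\bot)$: $\forall$, $\{(m,\bot)\mid gI^cm\}$; $(m,\top)$: $\exists$, $\{(g,\top)\mid gI^cm\}$; $(m,\varphi_1\vee\varphi_2)$: $\exists$, $\{(m,\varphi_1),(m,\varphi_2)\}$; $(g,\varphi_1\vee\varphi_2)$: $\forall$, $\{(m,\varphi_1\vee\varphi_2)\mid gI^cm\}$; $(g,\varphi_1\wedge\varphi_2)$: $\forall$, $\{(g,\varphi_1),(g,\varphi_2)\}$; $(m,\varphi_1\wedge\varphi_2)$: $\exists$, $\{(g,\varphi_1\wedge\varphi_2)\mid gI^cm\}$; $(m,\Diamond\varphi)$: $\exists$, $\{(g,\varphi)\mid mR_\Diamond^cg\}$; $(g,\Diamond\varphi)$: $\forall$, $\{(m,\Diamond\varphi)\mid gI^cm\}$; $(g,\Box\varphi)$: $\forall$, $\{(m,\varphi)\mid gR_\Box^cm\}$; $(m,\Box\varphi)$: $\exists$, $\{(g,\Box\varphi)\mid gI^cm\}$. -}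

module Defs where

open import Level using (0ℓ)
open import Data.Nat using (ℕ; _<_)
open import Data.Product using (Σ; _×_; _,_; proj₁; proj₂)
open import Data.Maybe using (Maybe; just; nothing)
import Data.Maybe as Maybe
open import Data.List using (List; applyUpTo)
open import Relation.Nullary using (¬_)
open import Relation.Binary.PropositionalEquality using (_≡_)
open import Function using (_⇔_)

data Fm : Set where
  ⊥′ ⊤′   : Fm
  atom    : ℕ → Fm
  _∧′_ _∨′_ : Fm → Fm → Fm
  □′ ◇′   : Fm → Fm

record Polarity : Set₁ where
  field
    G : Set
    M : Set
    I : G → M → Set

module _ (P : Polarity) where
  open Polarity P

  _↑ : (G → Set) → (M → Set)
  (B ↑) m = ∀ g → B g → I g m

  _↓ : (M → Set) → (G → Set)
  (Y ↓) g = ∀ m → Y m → I g m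

  StableG : (G → Set) → Set
  StableG B = (∀ g → B g → ((B ↑) ↓) g) × (∀ g → ((B ↑) ↓) g → B g)

  StableM : (M → Set) → Set
  StableM Y = (∀ m → Y m → ((Y ↓) ↑) m) × (∀ m → ((Y ↓) ↑) m → Y m)

  record Concept : Set₁ where
    field
      ext : G → Set
      int : M → Set
      ext≐ : (∀ g → ext g → (int ↓) g) × (∀ g → (int ↓) g → ext g)
      int≐ : (∀ m → int m → (ext ↑) m) × (∀ m → (ext ↑) m → int m)

record EnrichedContext : Set₁ where
  field
    pol : Polarity
  open Polarity pol public
  field
    R□ : G → M → Set
    R◇ : M → G → Set
    R□⁰-stable : ∀ m → StableG pol (λ g → R□ g m)
    R□¹-stable : ∀ g → StableM pol (λ m → R□ g m)
    R◇⁰-stable : ∀ g → StableM pol (λ m → R◇ m g)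
    R◇¹-stable : ∀ m → StableG pol (λ g → R◇ m g)

module Lattice (F : EnrichedContext) where
  open EnrichedContext F
  P = pol
  Conc = Concept pol
  open Concept

  fromExt : (B : G → Set) → StableG P B → Conc
  fromExt B (st₁ , st₂) = record
    { ext = B ; int = (_↑) P B
    ; ext≐ = st₁ , st₂
    ; int≐ = (λ m x → x) , (λ m x → x) }

  fromInt : (Y : M → Set) → StableM P Y → Conc
  fromInt Y (st₁ , st₂) = record
    { ext = (_↓) P Y ; int = Y
    ; ext≐ = (λ g x → x) , (λ g x → x)
    ; int≐ = st₁ , st₂ }

  ext-stable : (c : Conc) → StableG P (ext c)
  ext-stable c = (λ g b m bm → b' g b m bm) , λ g x → proj₂ (ext≐ c) g (λ m im → x m (proj₁ (int≐ c) m im))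
    where
    b' : ∀ g → ext c g → ∀ m → ((_↑) P (ext c)) m → I g m
    b' g b m bm = bm g b

  int-stable : (c : Conc) → StableM P (int c)
  int-stable c = (λ m y g yg → yg m y) , λ m x → proj₂ (int≐ c) m (λ g eg → x g (proj₁ (ext≐ c) g eg))

  ⊤c : Conc
  ⊤c = fromExt (λ _ → Data.Unit.⊤) ((λ g _ m f → f g _) , (λ _ _ → Data.Unit.tt))
    where import Data.Unit

  ⊥c : Conc
  ⊥c = fromInt (λ _ → Data.Unit.⊤) ((λ m _ g f → f m _) , (λ _ _ → Data.Unit.tt))
    where import Data.Unit

  _⊓_ : Conc → Conc → Conc
  a ⊓ b = fromExt (λ g → ext a g × ext b g)
    ((λ g x m f → f g x)
    , λ g x → proj₂ (ext-stable a) g (λ m fa → x m (λ g' y → fa g' (proj₁ y)))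
            , proj₂ (ext-stable b) g (λ m fb → x m (λ g' y → fb g' (proj₂ y))))

  _⊔_ : Conc → Conc → Conc
  a ⊔ b = fromInt (λ m → int a m × int b m)
    ((λ m x g f → f m x)
    , λ m x → proj₂ (int-stable a) m (λ g fa → x g (λ m' y → fa m' (proj₁ y)))
            , proj₂ (int-stable b) m (λ g fb → x g (λ m' y → fb m' (proj₂ y))))

  [R□] : Conc → Conc
  [R□] c = fromExt (λ g → ∀ m → int c m → R□ g m)
    ((λ g x m f → f g x)
    , λ g x m im → proj₂ (R□⁰-stable m) g (λ m' f → x m' (λ g' y → f g' (y m im))))

  ⟨R◇⟩ : Conc → Conc
  ⟨R◇⟩ c = fromInt (λ m → ∀ g → ext c g → R◇ m g)
    ((λ m x g f → f m x)
    , λ m x g eg → proj₂ (R◇⁰-stable g) m (λ g' f → x g' (λ m' y → f m' (y g eg))))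

module Semantics (F : EnrichedContext) (V : ℕ → Concept (EnrichedContext.pol F)) where
  open EnrichedContext F
  open Lattice F
  open Concept

  ⟦_⟧ : Fm → Conc
  ⟦ ⊥′ ⟧ = ⊥c
  ⟦ ⊤′ ⟧ = ⊤c
  ⟦ atom p ⟧ = V p
  ⟦ φ ∧′ ψ ⟧ = ⟦ φ ⟧ ⊓ ⟦ ψ ⟧
  ⟦ φ ∨′ ψ ⟧ = ⟦ φ ⟧ ⊔ ⟦ ψ ⟧
  ⟦ □′ φ ⟧ = [R□] ⟦ φ ⟧
  ⟦ ◇′ φ ⟧ = ⟨R◇⟩ ⟦ φ ⟧

  _⊩_ : G → Fm → Set
  g ⊩ φ = ext ⟦ φ ⟧ g

  _≻_ : M → Fm → Set
  m ≻ φ = int ⟦ φ ⟧ m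

  data Pos : Set where
    gpos : G → Fm → Pos
    mpos : M → Fm → Pos

  data Player : Set where
    ∃P ∀P : Player

  owner : Pos → Player
  owner (gpos _ _) = ∀P
  owner (mpos _ _) = ∃P

  data Move : Pos → Pos → Set where
    atom-g : ∀ {g m p} → ¬ (g ⊩ atom p) → ¬ I g m → Move (gpos g (atom p)) (mpos m (atom p))
    atom-m : ∀ {g m p} → ¬ (m ≻ atom p) → ¬ I g m → Move (mpos m (atom p)) (gpos g (atom p))
    bot-g  : ∀ {g m} → ¬ I g m → Move (gpos g ⊥′) (mpos m ⊥′)
    top-m  : ∀ {g m} → ¬ I g m → Move (mpos m ⊤′) (gpos g ⊤′)
    or-l   : ∀ {m φ ψ} → Move (mpos m (φ ∨′ ψ)) (mpos m φ)
    or-r   : ∀ {m φ ψ} → Move (mpos m (φ ∨′ ψ)) (mpos m ψ)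
    or-g   : ∀ {g m φ ψ} → ¬ I g m → Move (gpos g (φ ∨′ ψ)) (mpos m (φ ∨′ ψ))
    and-l  : ∀ {g φ ψ} → Move (gpos g (φ ∧′ ψ)) (gpos g φ)
    and-r  : ∀ {g φ ψ} → Move (gpos g (φ ∧′ ψ)) (gpos g ψ)
    and-m  : ∀ {g m φ ψ} → ¬ I g m → Move (mpos m (φ ∧′ ψ)) (gpos g (φ ∧′ ψ))
    dia-m  : ∀ {g m φ} → ¬ R◇ m g → Move (mpos m (◇′ φ)) (gpos g φ)
    dia-g  : ∀ {g m φ} → ¬ I g m → Move (gpos g (◇′ φ)) (mpos m (◇′ φ))
    box-g  : ∀ {g m φ} → ¬ R□ g m → Move (gpos g (□′ φ)) (mpos m φ)
    box-m  : ∀ {g m φ} → ¬ I g m → Move (mpos m (□′ φ)) (gpos g (□′ φ))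

  -- A strategy for ∃: given the history (positions before the current one)
  -- and the current ∃-position (m, φ), it proposes an admissible move
  -- (or nothing, in which case ∃ does not move and loses that play).
  Strategy∃ : Set
  Strategy∃ = List Pos → (m : M) (φ : Fm) → Maybe (Σ Pos (Move (mpos m φ)))

  hist : (ℕ → Pos) → ℕ → List Pos
  hist f i = applyUpTo f i

  StepOK : Strategy∃ → List Pos → Pos → Pos → Set
  StepOK σ h (gpos g φ) q = Move (gpos g φ) q
  StepOK σ h (mpos m φ) q = Maybe.map proj₁ (σ h m φ) ≡ just q

  Stops : Strategy∃ → List Pos → Pos → Set
  Stops σ h (gpos g φ) = ¬ Σ Pos (Move (gpos g φ))
  Stops σ h (mpos m φ) = σ h m φ ≡ nothing

  Follows : Strategy∃ → (ℕ → Pos) → ℕ → Set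
  Follows σ f i = StepOK σ (hist f i) (f i) (f (ℕ.suc i))
    where import Data.Nat as ℕ

  InfinitePlay : Strategy∃ → Pos → (ℕ → Pos) → Set
  InfinitePlay σ p₀ f = f 0 ≡ p₀ × (∀ i → Follows σ f i)

  FinitePlay : Strategy∃ → Pos → (ℕ → Pos) → ℕ → Set
  FinitePlay σ p₀ f n = f 0 ≡ p₀ × (∀ i → i < n → Follows σ f i) × Stops σ (hist f n) (f n)

  -- σ is winning for ∃ from p₀: no infinite play (those are won by ∀),
  -- and every finite play ends with ∀ unable to move
  Winning∃ : Strategy∃ → Pos → Set
  Winning∃ σ p₀ =
    (∀ f → ¬ InfinitePlay σ p₀ f) ×
    (∀ f n → FinitePlay σ p₀ f n → owner (f n) ≡ ∀P)

  ∃HasWinningStrategy : Pos → Set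
  ∃HasWinningStrategy p₀ = Σ Strategy∃ λ σ → Winning∃ σ p₀

-- The truth of the claim at a position (g ⊩ φ at (g, φ), m ⊁ φ at (m, φ)) is the invariant
-- of the game.  Every ∀-move from a true position reaches a true position, and classically
-- ∃ can always move from a true position to a true one (a non-member of an intension has a
-- counterexample object, a false disjunction a false disjunct).  So "always move to a true
-- position" confines every play to true positions, where ∃ is never stuck; and a move
-- between true positions either enters a subformula or switches side once at the same
-- formula, so these plays are finite.  Conversely, from a false position every move of ∃
-- leads to a false position and ∀ has a move to one, so by induction on the formula no
-- strategy of ∃ wins there.

module Submission where

open import Defs
open import Level using (0ℓ)
open import Data.Nat using (ℕ; zero; suc; _<_; _≤_; s≤s)
open import Data.Nat.Properties using (<⇒≤; ≤-refl)
open import Data.Product using (Σ; ∃; _×_; _,_; proj₁; proj₂)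
open import Data.Empty using (⊥-elim)
open import Data.Unit using (tt)
open import Data.Maybe using (Maybe; just; nothing)
import Data.Maybe as Maybe
open import Data.List using ([]; _∷_)
open import Relation.Nullary using (¬_; Dec; yes; no)
open import Relation.Binary.Core using (Rel)
open import Relation.Binary.PropositionalEquality using (_≡_; refl; sym; cong; subst)
open import Induction.WellFounded using (Acc; acc; WellFounded)
open import Function using (_⇔_)
open import Function.Bundles using (mk⇔)
open import Axiom.ExcludedMiddle using (ExcludedMiddle)
open import Axiom.DoubleNegationElimination using (DoubleNegationElimination; em⇒dne)

acc⇒¬descending : {A : Set} {_≺_ : Rel A 0ℓ} {x : A} → Acc _≺_ x →
                  (f : ℕ → A) → f 0 ≡ x → ¬ (∀ i → f (suc i) ≺ f i)
acc⇒¬descending (acc rs) f refl descending =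
  acc⇒¬descending (rs (descending 0)) (λ i → f (suc i)) refl (λ i → descending (suc i))

module Classical (dne : DoubleNegationElimination 0ℓ) where

  ¬∀⇒∃¬ : {A : Set} {P : A → Set} → ¬ (∀ a → P a) → ∃ λ a → ¬ P a
  ¬∀⇒∃¬ ¬∀ = dne λ ¬∃ → ¬∀ λ a → dne λ ¬Pa → ¬∃ (a , ¬Pa)

  ¬∀⇒∃×¬ : {A : Set} {P Q : A → Set} → ¬ (∀ a → P a → Q a) → ∃ λ a → P a × ¬ Q a
  ¬∀⇒∃×¬ ¬∀ with ¬∀⇒∃¬ ¬∀
  ... | a , ¬P⇒Q = a , dne (λ ¬Pa → ¬P⇒Q λ Pa → ⊥-elim (¬Pa Pa)) , λ Qa → ¬P⇒Q λ _ → Qa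

  module _ {P : Polarity} (c : Concept P) where
    open Polarity P
    open Concept c

    ext-intro : ∀ {g} → (∀ m → ¬ I g m → ¬ int m) → ext g
    ext-intro h = proj₂ ext≐ _ λ m im → dne λ ¬I → h m ¬I im

    ¬int⇒∃ext×¬I : ∀ {m} → ¬ int m → ∃ λ g → ext g × ¬ I g m
    ¬int⇒∃ext×¬I ¬int = ¬∀⇒∃×¬ λ h → ¬int (proj₂ int≐ _ h)

module Game (F : EnrichedContext) (V : ℕ → Concept (EnrichedContext.pol F)) where
  open Semantics F V

  AtFormula : (Pos → Set) → Fm → Set
  AtFormula P φ = (∀ g → P (gpos g φ)) × (∀ m → P (mpos m φ))

  by-formula : {P : Pos → Set} → (∀ φ → AtFormula P φ) → ∀ p → P p
  by-formula h (gpos g φ) = proj₁ (h φ) g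
  by-formula h (mpos m φ) = proj₂ (h φ) m

  shift : Strategy∃ → Pos → Strategy∃
  shift σ p h = σ (p ∷ h)

  _◂_ : Pos → (ℕ → Pos) → ℕ → Pos
  (p ◂ f) zero = p
  (p ◂ f) (suc i) = f i

  shift-step : ∀ {σ p h q r} → StepOK (shift σ p) h q r → StepOK σ (p ∷ h) q r
  shift-step {q = gpos _ _} s = s
  shift-step {q = mpos _ _} s = s

  shift-stops : ∀ {σ p h q} → Stops (shift σ p) h q → Stops σ (p ∷ h) q
  shift-stops {q = gpos _ _} s = s
  shift-stops {q = mpos _ _} s = s

  shift-winning : ∀ {σ p q} → StepOK σ [] p q → Winning∃ σ p → Winning∃ (shift σ p) q
  shift-winning {σ} {p} {q} first (no-infinite , finite-ends) = no-infinite′ , finite-ends′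
    where
    no-infinite′ : ∀ f → ¬ InfinitePlay (shift σ p) q f
    no-infinite′ f (f0≡q , follows) = no-infinite (p ◂ f) (refl , follows′)
      where
      follows′ : ∀ i → Follows σ (p ◂ f) i
      follows′ zero = subst (StepOK σ [] p) (sym f0≡q) first
      follows′ (suc i) = shift-step (follows i)

    finite-ends′ : ∀ f n → FinitePlay (shift σ p) q f n → owner (f n) ≡ ∀P
    finite-ends′ f n (f0≡q , follows , stops) =
      finite-ends (p ◂ f) (suc n) (refl , follows′ , shift-stops stops)
      where
      follows′ : ∀ i → i < suc n → Follows σ (p ◂ f) i
      follows′ zero _ = subst (StepOK σ [] p) (sym f0≡q) first
      follows′ (suc i) (s≤s i<n) = shift-step (follows i i<n)

  ∃-move-winning : ∀ {σ m φ} → Winning∃ σ (mpos m φ) →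
                   ∃ λ q → Move (mpos m φ) q × Winning∃ (shift σ (mpos m φ)) q
  ∃-move-winning {σ} {m} {φ} w with σ [] m φ in σ-answer
  ... | nothing with () ← proj₂ w (λ _ → mpos m φ) 0 (refl , (λ _ ()) , σ-answer)
  ... | just (q , move) = q , move , shift-winning (cong (Maybe.map proj₁) σ-answer) w

  MoveFrom : (Pos → Set) → Rel Pos 0ℓ
  MoveFrom Inv q p = Inv p × Move p q

  module _ (σ : Strategy∃) (Inv : Pos → Set)
           (preserved : ∀ {h p q} → Inv p → StepOK σ h p q → Inv q × Move p q)
           (stops-at-∀ : ∀ {h p} → Inv p → Stops σ h p → owner p ≡ ∀P)
           (wf : WellFounded (MoveFrom Inv)) where

    invariant-along : ∀ {f n} → Inv (f 0) → (∀ i → i < n → Follows σ f i) →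
                      ∀ i → i ≤ n → Inv (f i)
    invariant-along inv₀ follows zero _ = inv₀
    invariant-along inv₀ follows (suc i) i<n =
      proj₁ (preserved (invariant-along inv₀ follows i (<⇒≤ i<n)) (follows i i<n))

    invariant-winning : ∀ {p} → Inv p → Winning∃ σ p
    invariant-winning {p} inv = no-infinite , finite-ends
      where
      no-infinite : ∀ f → ¬ InfinitePlay σ p f
      no-infinite f (f0≡p , follows) =
        acc⇒¬descending (wf p) f f0≡p λ i → inv-at i , proj₂ (preserved (inv-at i) (follows i))
        where
        inv-at : ∀ i → Inv (f i)
        inv-at i = invariant-along (subst Inv (sym f0≡p) inv) (λ j _ → follows j) i ≤-refl

      finite-ends : ∀ f n → FinitePlay σ p f n → owner (f n) ≡ ∀P
      finite-ends f n (f0≡p , follows , stops) =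
        stops-at-∀ (invariant-along (subst Inv (sym f0≡p) inv) follows n ≤-refl) stops

module Adequacy (em : ExcludedMiddle 0ℓ) (F : EnrichedContext)
                (V : ℕ → Concept (EnrichedContext.pol F)) where
  open EnrichedContext F
  open Semantics F V
  open Game F V
  private
    dne : DoubleNegationElimination 0ℓ
    dne = em⇒dne em

  open Classical dne

  True : Pos → Set
  True (gpos g φ) = g ⊩ φ
  True (mpos m φ) = ¬ m ≻ φ

  true-∃-move : ∀ {m φ} → True (mpos m φ) → ∃ λ q → Move (mpos m φ) q × True q
  true-∃-move {φ = ⊥′} m⊁ = ⊥-elim (m⊁ tt)
  true-∃-move {φ = ⊤′} m⊁ with ¬int⇒∃ext×¬I ⟦ ⊤′ ⟧ m⊁
  ... | g , _ , ¬I = gpos g ⊤′ , top-m ¬I , tt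
  true-∃-move {φ = atom p} m⊁ with ¬int⇒∃ext×¬I (V p) m⊁
  ... | g , g⊩ , ¬I = gpos g (atom p) , atom-m m⊁ ¬I , g⊩
  true-∃-move {φ = φ ∧′ ψ} m⊁ with ¬int⇒∃ext×¬I ⟦ φ ∧′ ψ ⟧ m⊁
  ... | g , g⊩ , ¬I = gpos g (φ ∧′ ψ) , and-m ¬I , g⊩
  true-∃-move {m} {φ ∨′ ψ} m⊁ with em {m ≻ φ}
  ... | no ⊁φ = mpos m φ , or-l , ⊁φ
  ... | yes ≻φ = mpos m ψ , or-r , λ ≻ψ → m⊁ (≻φ , ≻ψ)
  true-∃-move {φ = □′ φ} m⊁ with ¬int⇒∃ext×¬I ⟦ □′ φ ⟧ m⊁
  ... | g , g⊩ , ¬I = gpos g (□′ φ) , box-m ¬I , g⊩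
  true-∃-move {φ = ◇′ φ} m⊁ with ¬∀⇒∃×¬ m⊁
  ... | g , g⊩ , ¬R = gpos g φ , dia-m ¬R , g⊩

  true-∀-move : ∀ {g φ q} → True (gpos g φ) → Move (gpos g φ) q → True q
  true-∀-move g⊩ (atom-g g⊮ _) = ⊥-elim (g⊮ g⊩)
  true-∀-move g⊩ (bot-g ¬I) = λ _ → ¬I (g⊩ _ tt)
  true-∀-move g⊩ (or-g ¬I) = λ m≻ → ¬I (g⊩ _ m≻)
  true-∀-move g⊩ and-l = proj₁ g⊩
  true-∀-move g⊩ and-r = proj₂ g⊩
  true-∀-move g⊩ (dia-g ¬I) = λ m≻ → ¬I (g⊩ _ m≻)
  true-∀-move g⊩ (box-g ¬R) = λ m≻ → ¬R (g⊩ _ m≻)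

  respond : ∀ m φ → Dec (m ≻ φ) → Maybe (Σ Pos (Move (mpos m φ)))
  respond _ _ (yes _) = nothing
  respond m φ (no m⊁) = just (proj₁ r , proj₁ (proj₂ r))
    where r = true-∃-move {m} {φ} m⊁

  truth-strategy : Strategy∃
  truth-strategy _ m φ = respond m φ em

  respond-true : ∀ {m φ q} (d : Dec (m ≻ φ)) →
                 Maybe.map proj₁ (respond m φ d) ≡ just q → True q × Move (mpos m φ) q
  respond-true (yes _) ()
  respond-true {m} {φ} (no m⊁) refl = proj₂ (proj₂ r) , proj₁ (proj₂ r)
    where r = true-∃-move {m} {φ} m⊁

  respond-moves : ∀ {m φ} (d : Dec (m ≻ φ)) → True (mpos m φ) → ¬ respond m φ d ≡ nothing
  respond-moves (yes m≻) m⊁ _ = m⊁ m≻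
  respond-moves (no _) _ ()

  truth-preserved : ∀ {h p q} → True p → StepOK truth-strategy h p q → True q × Move p q
  truth-preserved {p = gpos _ _} g⊩ move = true-∀-move g⊩ move , move
  truth-preserved {p = mpos _ _} _ answer = respond-true em answer

  truth-stops-at-∀ : ∀ {h p} → True p → Stops truth-strategy h p → owner p ≡ ∀P
  truth-stops-at-∀ {p = gpos _ _} _ _ = refl
  truth-stops-at-∀ {p = mpos _ _} m⊁ answer = ⊥-elim (respond-moves em m⊁ answer)

  true-moves-accessible : ∀ φ → AtFormula (Acc (MoveFrom True)) φ
  true-moves-accessible ⊥′ = at-g , λ m → acc λ { (_ , ()) }
    where
    at-g : ∀ g → Acc (MoveFrom True) (gpos g ⊥′)
    at-g g = acc λ { (g⊩ , bot-g ¬I) → ⊥-elim (¬I (g⊩ _ tt)) }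
  true-moves-accessible ⊤′ = at-g , λ m → acc λ { (_ , top-m _) → at-g _ }
    where
    at-g : ∀ g → Acc (MoveFrom True) (gpos g ⊤′)
    at-g g = acc λ { (_ , ()) }
  true-moves-accessible (atom p) = at-g , λ m → acc λ { (_ , atom-m _ _) → at-g _ }
    where
    at-g : ∀ g → Acc (MoveFrom True) (gpos g (atom p))
    at-g g = acc λ { (g⊩ , atom-g g⊮ _) → ⊥-elim (g⊮ g⊩) }
  true-moves-accessible (φ ∧′ ψ) = at-g , λ m → acc λ { (_ , and-m _) → at-g _ }
    where
    at-g : ∀ g → Acc (MoveFrom True) (gpos g (φ ∧′ ψ))
    at-g g = acc λ { (_ , and-l) → proj₁ (true-moves-accessible φ) g
                   ; (_ , and-r) → proj₁ (true-moves-accessible ψ) g }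
  true-moves-accessible (φ ∨′ ψ) = (λ g → acc λ { (_ , or-g _) → at-m _ }) , at-m
    where
    at-m : ∀ m → Acc (MoveFrom True) (mpos m (φ ∨′ ψ))
    at-m m = acc λ { (_ , or-l) → proj₂ (true-moves-accessible φ) m
                   ; (_ , or-r) → proj₂ (true-moves-accessible ψ) m }
  true-moves-accessible (□′ φ) = at-g , λ m → acc λ { (_ , box-m _) → at-g _ }
    where
    at-g : ∀ g → Acc (MoveFrom True) (gpos g (□′ φ))
    at-g g = acc λ { (_ , box-g _) → proj₂ (true-moves-accessible φ) _ }
  true-moves-accessible (◇′ φ) = (λ g → acc λ { (_ , dia-g _) → at-m _ }) , at-m
    where
    at-m : ∀ m → Acc (MoveFrom True) (mpos m (◇′ φ))
    at-m m = acc λ { (_ , dia-m _) → proj₁ (true-moves-accessible φ) _ }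

  true⇒winning : ∀ p → True p → ∃HasWinningStrategy p
  true⇒winning p t = truth-strategy ,
    invariant-winning truth-strategy True truth-preserved truth-stops-at-∀
                      (by-formula true-moves-accessible) t

  TrueIfWinning : Pos → Set
  TrueIfWinning p = ∀ {σ} → Winning∃ σ p → True p

  -- At ⊥, ∨, ◇ and atoms, ∀ answers (g, φ) by some (m, φ) with g ̸I m; since ∃ must then
  -- win at (m, φ), such m are not in the intension, so g is in the extension.
  true-at-g : ∀ {g φ} → (∀ {m} → ¬ g ⊩ φ → ¬ I g m → Move (gpos g φ) (mpos m φ)) →
              (∀ m → TrueIfWinning (mpos m φ)) → TrueIfWinning (gpos g φ)
  true-at-g {φ = φ} ∀-move at-m w =
    dne λ g⊮ → g⊮ (ext-intro ⟦ φ ⟧ λ m ¬I → at-m m (shift-winning (∀-move g⊮ ¬I) w))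

  winning⇒true : ∀ φ → AtFormula TrueIfWinning φ
  winning⇒true ⊥′ = (λ g → true-at-g (λ _ → bot-g) at-m) , at-m
    where
    at-m : ∀ m → TrueIfWinning (mpos m ⊥′)
    at-m m w _ with ∃-move-winning w
    ... | _ , () , _
  winning⇒true ⊤′ = (λ g _ → tt) , at-m
    where
    at-m : ∀ m → TrueIfWinning (mpos m ⊤′)
    at-m m w m≻ with ∃-move-winning w
    ... | _ , top-m ¬I , _ = ¬I (m≻ _ tt)
  winning⇒true (atom p) = (λ g → true-at-g atom-g at-m) , at-m
    where
    at-m : ∀ m → TrueIfWinning (mpos m (atom p))
    at-m m w m≻ with ∃-move-winning w
    ... | _ , atom-m m⊁ _ , _ = m⊁ m≻
  winning⇒true (φ ∧′ ψ) = at-g , at-m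
    where
    at-g : ∀ g → TrueIfWinning (gpos g (φ ∧′ ψ))
    at-g g w = proj₁ (winning⇒true φ) g (shift-winning and-l w)
             , proj₁ (winning⇒true ψ) g (shift-winning and-r w)
    at-m : ∀ m → TrueIfWinning (mpos m (φ ∧′ ψ))
    at-m m w m≻ with ∃-move-winning w
    ... | _ , and-m ¬I , w′ = ¬I (m≻ _ (at-g _ w′))
  winning⇒true (φ ∨′ ψ) = (λ g → true-at-g (λ _ → or-g) at-m) , at-m
    where
    at-m : ∀ m → TrueIfWinning (mpos m (φ ∨′ ψ))
    at-m m w m≻ with ∃-move-winning w
    ... | _ , or-l , w′ = proj₂ (winning⇒true φ) m w′ (proj₁ m≻)
    ... | _ , or-r , w′ = proj₂ (winning⇒true ψ) m w′ (proj₂ m≻)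
  winning⇒true (□′ φ) = at-g , at-m
    where
    at-g : ∀ g → TrueIfWinning (gpos g (□′ φ))
    at-g g w m m≻ = dne λ ¬R → proj₂ (winning⇒true φ) m (shift-winning (box-g ¬R) w) m≻
    at-m : ∀ m → TrueIfWinning (mpos m (□′ φ))
    at-m m w m≻ with ∃-move-winning w
    ... | _ , box-m ¬I , w′ = ¬I (m≻ _ (at-g _ w′))
  winning⇒true (◇′ φ) = (λ g → true-at-g (λ _ → dia-g) at-m) , at-m
    where
    at-m : ∀ m → TrueIfWinning (mpos m (◇′ φ))
    at-m m w m≻ with ∃-move-winning w
    ... | _ , dia-m ¬R , w′ = ¬R (m≻ _ (proj₁ (winning⇒true φ) _ w′))

  true⇔winning : ∀ p → True p ⇔ ∃HasWinningStrategy p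
  true⇔winning p = mk⇔ (true⇒winning p) λ (_ , w) → by-formula {TrueIfWinning} winning⇒true p w

theorem5 : ExcludedMiddle 0ℓ →
    (F : EnrichedContext) (V : ℕ → Concept (EnrichedContext.pol F)) (φ : Fm) →
    (∀ g → (Semantics._⊩_ F V g φ ⇔ Semantics.∃HasWinningStrategy F V (Semantics.gpos g φ))) ×
    (∀ m → ((¬ Semantics._≻_ F V m φ) ⇔ Semantics.∃HasWinningStrategy F V (Semantics.mpos m φ)))
theorem5 em F V φ = (λ g → true⇔winning (gpos g φ)) , (λ m → true⇔winning (mpos m φ))
  where
  open Semantics F V using (gpos; mpos)
  open Adequacy em F V using (true⇔winning)
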